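{- Let $N$ be a positive integer and let $X = \{(a_1,b_1),(a_2,b_2),\dots,(a_{2N+1},b_{2N+1})\}$ be a subset of $\mathbb{Z}_N^2$ with $2N+1$ elements which contains all elements of a particular row, i.e. $a_1 = a_2 = \cdots = a_N$. Then there exist $N$ distinct elements of $X$ whose sum is $(0,0)$.
   Context: $\mathbb{Z}_N^2=\mathbb{Z}_N\times\mathbb{Z}_N$. The row with value $a$ is the set $\{(a,y): y\in\mathbb{Z}_N\}$ of elements with first coordinate $a$; since $X$ is a set, $N$ elements with the same first coordinate $a$ constitute the whole row $\{a\}\times \mathbb{Z}_N$. -}

module Defs where

open import Data.Nat using (ℕ; zero; suc; _+_; _%_; NonZero)
open import Data.Fin using (Fin; zero; suc; toℕ)
open import Data.Product using (_×_; proj₁; proj₂; ∃-syntax; _,_)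
open import Relation.Binary.PropositionalEquality using (_≡_)
open import Function.Definitions using (Injective)

-- Z_N is modelled by Fin N (residues 0..N-1); Z_N^2 by Fin N × Fin N.
ZN² : ℕ → Set
ZN² N = Fin N × Fin N

Σℕ : ∀ {k} → (Fin k → ℕ) → ℕ
Σℕ {zero}  f = 0
Σℕ {suc k} f = f zero + Σℕ (λ i → f (suc i))

SumsToZero : (N : ℕ) .{{_ : NonZero N}} → ∀ {k} → (Fin k → ZN² N) → Set
SumsToZero N x =
  (Σℕ (λ j → toℕ (proj₁ (x j))) % N ≡ 0) × (Σℕ (λ j → toℕ (proj₂ (x j))) % N ≡ 0)

-- a set X ⊆ Z_N^2 of size m, given by an injective enumeration x : Fin m → Z_N^2,
-- contains a whole row {a} × Z_N
ContainsRow : ∀ {N m} → (Fin m → ZN² N) → Set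
ContainsRow {N} {m} x = ∃[ a ] ((y : Fin N) → ∃[ i ] (x i ≡ (a , y)))

{-# OPTIONS --safe #-}
module Submission where

-- The row {a} × ℤ_N contains at most N points of X, so at least N + 1 points lie off it.
-- Their first coordinates minus a are N + 1 nonzero residues, not all equal (N + 1 distinct
-- points do not fit in one row), and pigeonholing their prefix sums together with one sum
-- that skips a term yields k of them, 1 ≤ k < N, with zero sum: these k points have first
-- coordinates summing to k·a. Add N − k points of the row whose second coordinates are
-- distinct residues with a prescribed sum, which is possible for every target because
-- 1 ≤ N − k < N; choosing the target to cancel the k second coordinates gives N points
-- whose first coordinates sum to N·a = 0 and whose second coordinates sum to 0.

open import Defs
open import Data.Nat
  using (ℕ; zero; suc; pred; _+_; _*_; _∸_; _≤_; _<_; z≤n; s≤s; s≤s⁻¹; s<s⁻¹; _≟_; _%_; NonZero; >-nonZero⁻¹)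
open import Data.Nat.Properties
open import Data.Nat.DivMod hiding (_mod_)
open import Data.Nat.ListAction using (sum)
open import Data.Nat.ListAction.Properties using (sum-++)
open import Data.Nat.Tactic.RingSolver using (solve-∀)
open import Data.Fin as Fin using (Fin; toℕ; fromℕ<; zero; suc)
import Data.Fin.Properties as Finₚ
open import Data.List using (List; []; _∷_; map; length; filter; allFin; lookup; _++_; downFrom)
open import Data.List.Properties
  using (map-∘; map-++; map-cong; length-map; length-++; length-tabulate; length-downFrom)
open import Data.List.Membership.Propositional.Properties using (∈-lookup; ∈-downFrom⁻)
open import Data.List.Relation.Unary.All as All using (All; []; _∷_)
import Data.List.Relation.Unary.All.Properties as Allₚ
open import Data.List.Relation.Unary.Unique.Propositional using (Unique; []; _∷_)
import Data.List.Relation.Unary.Unique.Propositional.Properties as Uniqueₚ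
open import Data.Product using (_×_; _,_; proj₁; proj₂; ∃-syntax; ∃₂)
open import Data.Sum using (inj₁; inj₂)
open import Data.Empty using (⊥-elim)
open import Function using (_∘_; id)
open import Function.Definitions using (Injective)
open import Relation.Nullary using (¬_; ¬?; yes; no)
open import Relation.Nullary.Decidable using (decidable-stable)
open import Relation.Unary using (Decidable)
open import Relation.Unary.Properties using (∁?)
open import Relation.Binary.Definitions using (tri<; tri≈; tri>)
open import Relation.Binary.PropositionalEquality
  using (_≡_; refl; sym; trans; cong; cong₂; subst; _≢_; module ≡-Reasoning)

private
  variable
    A B : Set

-- Congruence modulo N

infix 4 _≡_mod_

_≡_mod_ : ℕ → ℕ → (N : ℕ) .{{_ : NonZero N}} → Set
m ≡ n mod N = m % N ≡ n % N

module _ {N : ℕ} .{{_ : NonZero N}} where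

  +-congʳ-mod : ∀ {m n} o → m ≡ n mod N → m + o ≡ n + o mod N
  +-congʳ-mod {m} {n} o eq = begin
    (m + o) % N             ≡⟨ %-distribˡ-+ m o N ⟩
    (m % N + o % N) % N     ≡⟨ cong (λ r → (r + o % N) % N) eq ⟩
    (n % N + o % N) % N     ≡⟨ %-distribˡ-+ n o N ⟨
    (n + o) % N             ∎
    where open ≡-Reasoning

  +-congˡ-mod : ∀ {m n} o → m ≡ n mod N → o + m ≡ o + n mod N
  +-congˡ-mod {m} {n} o eq = begin
    (o + m) % N ≡⟨ cong (_% N) (+-comm o m) ⟩
    (m + o) % N ≡⟨ +-congʳ-mod o eq ⟩
    (n + o) % N ≡⟨ cong (_% N) (+-comm n o) ⟩
    (o + n) % N ∎
    where open ≡-Reasoning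

  +-cancelˡ-mod : ∀ o {m n} → o + m ≡ o + n mod N → m ≡ n mod N
  +-cancelˡ-mod o {m} {n} eq = begin
    m % N                    ≡⟨ [m+kn]%n≡m%n m o N ⟨
    (m + o * N) % N          ≡⟨ cong (_% N) (absorb m) ⟩
    (o + m + pred N * o) % N ≡⟨ +-congʳ-mod (pred N * o) eq ⟩
    (o + n + pred N * o) % N ≡⟨ cong (_% N) (absorb n) ⟨
    (n + o * N) % N          ≡⟨ [m+kn]%n≡m%n n o N ⟩
    n % N                    ∎
    where
    open ≡-Reasoning
    absorb : ∀ k → k + o * N ≡ o + k + pred N * o
    absorb k = begin
      k + o * N               ≡⟨ cong (λ n → k + o * n) (suc-pred N) ⟨
      k + o * suc (pred N)    ≡⟨ shuffle k o (pred N) ⟩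
      o + k + pred N * o      ∎
      where
      shuffle : ∀ k o p → k + o * suc p ≡ o + k + p * o
      shuffle = solve-∀

  +-cancelʳ-mod : ∀ o {m n} → m + o ≡ n + o mod N → m ≡ n mod N
  +-cancelʳ-mod o {m} {n} eq =
    +-cancelˡ-mod o (trans (cong (_% N) (+-comm o m)) (trans eq (cong (_% N) (+-comm n o))))

  0%N≡0 : 0 % N ≡ 0
  0%N≡0 = m<n⇒m%n≡m (>-nonZero⁻¹ N)

  N≡1⇒≡-mod : ∀ {m n} → N ≡ 1 → m ≡ n mod N
  N≡1⇒≡-mod {m} {n} N≡1 = begin
    m % N ≡⟨ %-congʳ N≡1 ⟩
    m % 1 ≡⟨ n%1≡0 m ⟩
    0     ≡⟨ n%1≡0 n ⟨
    n % 1 ≡⟨ %-congʳ N≡1 ⟨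
    n % N ∎
    where open ≡-Reasoning

  toℕ-injective-mod : ∀ {u v : Fin N} → toℕ u ≡ toℕ v mod N → u ≡ v
  toℕ-injective-mod {u} {v} eq = Finₚ.toℕ-injective (begin
    toℕ u     ≡⟨ m<n⇒m%n≡m (Finₚ.toℕ<n u) ⟨
    toℕ u % N ≡⟨ eq ⟩
    toℕ v % N ≡⟨ m<n⇒m%n≡m (Finₚ.toℕ<n v) ⟩
    toℕ v     ∎)
    where open ≡-Reasoning

  residue : ℕ → Fin N
  residue n = fromℕ< (m%n<n n N)

  toℕ-residue : ∀ n → toℕ (residue n) ≡ n % N
  toℕ-residue n = Finₚ.toℕ-fromℕ< (m%n<n n N)

  residue≡⇒≡mod : ∀ {m n} → residue m ≡ residue n → m ≡ n mod N
  residue≡⇒≡mod {m} {n} e = trans (sym (toℕ-residue m)) (trans (cong toℕ e) (toℕ-residue n))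

  n+pred[N]*n≡0-mod : ∀ n → n + pred N * n ≡ 0 mod N
  n+pred[N]*n≡0-mod n = begin
    (suc (pred N) * n) % N ≡⟨ cong (λ k → k * n % N) (suc-pred N) ⟩
    (N * n) % N            ≡⟨ cong (_% N) (*-comm N n) ⟩
    (n * N) % N            ≡⟨ m*n%n≡0 n N ⟩
    0                      ≡⟨ 0%N≡0 ⟨
    0 % N                  ∎
    where open ≡-Reasoning

  sum-map-% : ∀ ns → sum (map (_% N) ns) ≡ sum ns mod N
  sum-map-% [] = refl
  sum-map-% (n ∷ ns) = begin
    (n % N + sum (map (_% N) ns)) % N               ≡⟨ %-distribˡ-+ (n % N) _ N ⟩
    (n % N % N + sum (map (_% N) ns) % N) % N       ≡⟨ cong₂ (λ a b → (a + b) % N) (m%n%n≡m%n n N) (sum-map-% ns) ⟩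
    (n % N + sum ns % N) % N                        ≡⟨ %-distribˡ-+ n (sum ns) N ⟨
    (n + sum ns) % N                                ∎
    where open ≡-Reasoning

length-filter-∁ : {P : A → Set} (P? : Decidable P) (xs : List A) →
  length (filter P? xs) + length (filter (∁? P?) xs) ≡ length xs
length-filter-∁ P? [] = refl
length-filter-∁ P? (x ∷ xs) with P? x
... | yes _ = cong suc (length-filter-∁ P? xs)
... | no _  = trans (+-suc _ _) (cong suc (length-filter-∁ P? xs))

unique-map-injectiveOn : {P : A → Set} {f : A → B} {xs : List A} →
  (∀ {u v} → P u → P v → f u ≡ f v → u ≡ v) → All P xs → Unique xs → Unique (map f xs)
unique-map-injectiveOn inj [] [] = []
unique-map-injectiveOn {f = f} inj (pu ∷ pxs) (u∉ ∷ u) = distinct pxs u∉ ∷ unique-map-injectiveOn inj pxs u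
  where
  distinct : ∀ {ys} → All _ ys → All (_ ≢_) ys → All (f _ ≢_) (map f ys)
  distinct [] [] = []
  distinct (pv ∷ pys) (u≢v ∷ ns) = (λ e → u≢v (inj pu pv e)) ∷ distinct pys ns

lookup-injective : {xs : List A} → Unique xs → Injective _≡_ _≡_ (lookup xs)
lookup-injective (_ ∷ _)  {zero}  {zero}  _ = refl
lookup-injective (x∉ ∷ _) {zero}  {suc j} e = ⊥-elim (All.lookup x∉ (∈-lookup j) e)
lookup-injective (x∉ ∷ _) {suc i} {zero}  e = ⊥-elim (All.lookup x∉ (∈-lookup i) (sym e))
lookup-injective (_ ∷ u)  {suc i} {suc j} e = cong suc (lookup-injective u e)

Σℕ-lookup : (h : A → ℕ) (xs : List A) → Σℕ (λ i → h (lookup xs i)) ≡ sum (map h xs)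
Σℕ-lookup h []       = refl
Σℕ-lookup h (x ∷ xs) = cong (h x +_) (Σℕ-lookup h xs)

enumeration : ∀ {n} (xs : List A) → Unique xs → length xs ≡ n →
  ∃[ g ] (Injective _≡_ _≡_ g × ((h : A → ℕ) → Σℕ {n} (λ i → h (g i)) ≡ sum (map h xs)))
enumeration xs u refl = lookup xs , lookup-injective u , λ h → Σℕ-lookup h xs

lookupOr : A → List A → ℕ → A
lookupOr d []       n       = d
lookupOr d (x ∷ xs) zero    = x
lookupOr d (x ∷ xs) (suc n) = lookupOr d xs n

lookupOr-All : {P : A → Set} (d : A) {xs : List A} {n : ℕ} → All P xs → n < length xs → P (lookupOr d xs n)
lookupOr-All d {n = zero}  (px ∷ _)  _  = px
lookupOr-All d {n = suc n} (_ ∷ pxs) lt = lookupOr-All d pxs (s<s⁻¹ lt)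

lookupOr-injective : (d : A) {xs : List A} → Unique xs → ∀ {m n} → m < length xs → n < length xs →
  lookupOr d xs m ≡ lookupOr d xs n → m ≡ n
lookupOr-injective d (_ ∷ _)  {zero}  {zero}  _  _  _ = refl
lookupOr-injective d (x∉ ∷ _) {zero}  {suc n} _  lt e = ⊥-elim (lookupOr-All d x∉ (s<s⁻¹ lt) e)
lookupOr-injective d (x∉ ∷ _) {suc m} {zero}  lt _  e = ⊥-elim (lookupOr-All d x∉ (s<s⁻¹ lt) (sym e))
lookupOr-injective d (_ ∷ u)  {suc m} {suc n} lt lt′ e =
  cong suc (lookupOr-injective d u (s<s⁻¹ lt) (s<s⁻¹ lt′) e)

sum-map-+ : (h : A → ℕ) (c : ℕ) (xs : List A) →
  sum (map (λ x → h x + c) xs) ≡ sum (map h xs) + length xs * c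
sum-map-+ h c []       = refl
sum-map-+ h c (x ∷ xs) = begin
  h x + c + sum (map (λ x → h x + c) xs)     ≡⟨ cong (h x + c +_) (sum-map-+ h c xs) ⟩
  h x + c + (sum (map h xs) + length xs * c) ≡⟨ shuffle (h x) c (sum (map h xs)) (length xs * c) ⟩
  h x + sum (map h xs) + (c + length xs * c) ∎
  where
  open ≡-Reasoning
  shuffle : ∀ a c s t → a + c + (s + t) ≡ a + s + (c + t)
  shuffle = solve-∀

sum-map-++ : (h : A → ℕ) (xs ys : List A) → sum (map h (xs ++ ys)) ≡ sum (map h xs) + sum (map h ys)
sum-map-++ h xs ys = trans (cong sum (map-++ h xs ys)) (sum-++ (map h xs) (map h ys))

sum-map-const : (h : A → ℕ) (c : ℕ) {xs : List A} → All (λ x → h x ≡ c) xs → sum (map h xs) ≡ length xs * c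
sum-map-const h c []       = refl
sum-map-const h c (e ∷ es) = cong₂ _+_ e (sum-map-const h c es)

-- Intervals and prefix sums

interval : ℕ → ℕ → List ℕ
interval i zero    = []
interval i (suc k) = i ∷ interval (suc i) k

interval-length : ∀ i k → length (interval i k) ≡ k
interval-length i zero    = refl
interval-length i (suc k) = cong suc (interval-length (suc i) k)

interval-≥ : ∀ i k → All (i ≤_) (interval i k)
interval-≥ i zero    = []
interval-≥ i (suc k) = ≤-refl ∷ All.map (≤-trans (n≤1+n i)) (interval-≥ (suc i) k)

interval-< : ∀ i k → All (_< i + k) (interval i k)
interval-< i zero    = []
interval-< i (suc k) = subst (λ n → All (_< n) (interval i (suc k))) (sym (+-suc i k))
  (s≤s (m≤m+n i k) ∷ interval-< (suc i) k)

interval-unique : ∀ i k → Unique (interval i k)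
interval-unique i zero    = []
interval-unique i (suc k) = All.map (λ i<n → <⇒≢ i<n) (interval-≥ (suc i) k) ∷ interval-unique (suc i) k

prefixSum : (ℕ → ℕ) → ℕ → ℕ
prefixSum f zero    = 0
prefixSum f (suc k) = prefixSum f k + f k

prefixSum-+ : ∀ f i k → prefixSum f (i + k) ≡ prefixSum f i + sum (map f (interval i k))
prefixSum-+ f i zero    = trans (cong (prefixSum f) (+-identityʳ i)) (sym (+-identityʳ _))
prefixSum-+ f i (suc k) = begin
  prefixSum f (i + suc k)                                    ≡⟨ cong (prefixSum f) (+-suc i k) ⟩
  prefixSum f (suc i + k)                                    ≡⟨ prefixSum-+ f (suc i) k ⟩
  prefixSum f i + f i + sum (map f (interval (suc i) k))     ≡⟨ +-assoc (prefixSum f i) (f i) _ ⟩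
  prefixSum f i + sum (map f (interval i (suc k)))           ∎
  where open ≡-Reasoning

-- Sums of distinct residues

-- Greedy: raise the largest element of {0, …, m-1} by as much of S as it
-- can absorb (at most K), and recurse on the rest.
distinct-below-with-sum : ∀ m K S → S ≤ m * K →
  ∃[ ys ] (length ys ≡ m × Unique ys × All (_< m + K) ys × sum ys ≡ S + sum (downFrom m))
distinct-below-with-sum zero K S S≤0 with n≤0⇒n≡0 S≤0
... | refl = [] , refl , [] , [] , refl
distinct-below-with-sum (suc m) K S S≤ with S <? K
... | yes S<K =
  m + S ∷ downFrom m ,
  cong suc (length-downFrom m) ,
  All.map (λ n<m e → <⇒≢ (≤-trans n<m (m≤m+n m S)) (sym e)) below-m ∷ Uniqueₚ.downFrom⁺ m ,
  s≤s (+-monoʳ-≤ m (<⇒≤ S<K)) ∷ All.map (λ n<m → <-≤-trans n<m (≤-trans (m≤m+n m K) (n≤1+n _))) below-m ,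
  shuffle m S (sum (downFrom m))
  where
  below-m : All (_< m) (downFrom m)
  below-m = All.tabulate ∈-downFrom⁻
  shuffle : ∀ m S T → m + S + T ≡ S + (m + T)
  shuffle = solve-∀
... | no S≮K with distinct-below-with-sum m K (S ∸ K) (≤-trans (∸-monoˡ-≤ K S≤) (≤-reflexive (m+n∸m≡n K (m * K))))
...   | ys , len , u , ys<m+K , sum≡ =
  m + K ∷ ys ,
  cong suc len ,
  All.map (λ y< e → <⇒≢ y< (sym e)) ys<m+K ∷ u ,
  ≤-refl ∷ All.map m<n⇒m<1+n ys<m+K ,
  (begin
    m + K + sum ys                          ≡⟨ cong (m + K +_) sum≡ ⟩
    m + K + (S ∸ K + sum (downFrom m))      ≡⟨ shuffle m K (S ∸ K) (sum (downFrom m)) ⟩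
    (S ∸ K + K) + (m + sum (downFrom m))    ≡⟨ cong (_+ (m + sum (downFrom m))) (m∸n+n≡m (≮⇒≥ S≮K)) ⟩
    S + (m + sum (downFrom m))              ∎)
  where
  open ≡-Reasoning
  shuffle : ∀ m K R T → m + K + (R + T) ≡ (R + K) + (m + T)
  shuffle = solve-∀

distinct-residues-with-sum : ∀ {N} .{{_ : NonZero N}} m K → m + K ≡ N → 1 ≤ m → 1 ≤ K → ∀ t →
  ∃[ vs ] (length vs ≡ m × Unique vs × All (_< N) vs × (sum vs ≡ t mod N))
distinct-residues-with-sum (suc m) (suc K) refl _ _ t =
  let vs , len , u , vs<N , sum≡ = distinct-below-with-sum (suc m) (suc K) (X % N) X%N≤
  in  vs , len , u , vs<N , ≡t sum≡
  where
  N T X : ℕ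
  N = suc m + suc K
  T = sum (downFrom (suc m))
  X = t + pred N * T
  X%N≤ : X % N ≤ suc m * suc K
  X%N≤ = ≤-trans (s≤s⁻¹ (m%n<n X N))
    (≤-trans (≤-reflexive (+-comm m (suc K))) (+-monoʳ-≤ (suc K) (m≤m*n m (suc K))))
  shuffle : ∀ t p T → t + p * T + T ≡ t + T * suc p
  shuffle = solve-∀
  ≡t : ∀ {s} → s ≡ X % N + T → s ≡ t mod N
  ≡t {s} refl = begin
    (X % N + T) % N        ≡⟨ +-congʳ-mod {m = X % N} {n = X} T (m%n%n≡m%n X N) ⟩
    (X + T) % N            ≡⟨ cong (_% N) (shuffle t (pred N) T) ⟩
    (t + T * N) % N        ≡⟨ [m+kn]%n≡m%n t T N ⟩
    t % N                  ∎
    where open ≡-Reasoning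

-- Short zero-sum subsequences

record ShortZeroSum (N : ℕ) .{{_ : NonZero N}} (w : A → ℕ) (P : A → Set) : Set where
  field
    elements : List A
    unique   : Unique elements
    all      : All P elements
    nonempty : 1 ≤ length elements
    short    : length elements < N
    sum≡0    : sum (map w elements) ≡ 0 mod N

ShortZeroSum-map : ∀ {N} .{{_ : NonZero N}} {w : B → ℕ} {P : A → Set} {Q : B → Set} (y : A → B) →
  (∀ {u v} → P u → P v → y u ≡ y v → u ≡ v) → (∀ {u} → P u → Q (y u)) →
  ShortZeroSum N (w ∘ y) P → ShortZeroSum N w Q
ShortZeroSum-map {N = N} y y-inj P⇒Q Z = record
  { elements = map y elements
  ; unique   = unique-map-injectiveOn y-inj all unique
  ; all      = Allₚ.map⁺ (All.map P⇒Q all)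
  ; nonempty = subst (1 ≤_) (sym (length-map y elements)) nonempty
  ; short    = subst (_< N) (sym (length-map y elements)) short
  ; sum≡0    = trans (cong (λ ws → sum ws % N) (sym (map-∘ elements))) sum≡0
  }
  where open ShortZeroSum Z

module _ {N : ℕ} .{{_ : NonZero N}} (f : ℕ → ℕ) where

  private
    S : ℕ → ℕ
    S = prefixSum f

  collision-zeroSum : (P : List ℕ) → Unique P → All (_< N) P → ∀ {ℓ} → length P ≡ ℓ → 1 ≤ ℓ → ℓ < N →
    ∀ c → c ≡ c + sum (map f P) mod N → ShortZeroSum N f (_< N)
  collision-zeroSum P u P<N refl 1≤ℓ ℓ<N c eq = record
    { elements = P ; unique = u ; all = P<N ; nonempty = 1≤ℓ ; short = ℓ<N
    ; sum≡0    = sym (+-cancelˡ-mod c (trans (cong (_% N) (+-identityʳ c)) eq))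
    }

  block-zeroSum : ∀ {s t} → s < t → t < N → S s ≡ S t mod N → ShortZeroSum N f (_< N)
  block-zeroSum {s} s<t t<N eq with k , refl ← m≤n⇒∃[o]m+o≡n s<t =
    collision-zeroSum (interval s (suc k)) (interval-unique s (suc k))
      (All.map (λ p → <-≤-trans p (≤-trans (≤-reflexive (+-suc s k)) (<⇒≤ t<N))) (interval-< s (suc k)))
      (interval-length s (suc k)) (s≤s z≤n) (≤-<-trans (s≤s (m≤n+m k s)) t<N)
      (S s) (trans eq (cong (_% N) (trans (cong S (sym (+-suc s k))) (prefixSum-+ f s (suc k)))))

  -- Besides the prefix sums S 0, …, S (N-1), the pigeonhole uses W = S j + f (j+1), the sum
  -- over {0, …, j-1} ∪ {j+1}; a collision of W with some S l gives a short zero sum unless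
  -- f (j+1) ≡ 0 or f j ≡ f (j+1).
  module _ (j : ℕ) (sj<N : suc j < N) (f≢ : ¬ f j ≡ f (suc j) mod N) (f≢0 : ¬ f (suc j) ≡ 0 mod N) where

    private
      W : ℕ
      W = S j + f (suc j)

    skip-below-zeroSum : ∀ l k → l + k ≡ j → W ≡ S l mod N → ShortZeroSum N f (_< N)
    skip-below-zeroSum l k l+k≡j eq =
      collision-zeroSum (suc j ∷ interval l k)
        (All.map (λ p e → <⇒≢ (m<n⇒m<1+n p) (sym e)) below-j ∷ interval-unique l k)
        (sj<N ∷ All.map (λ p → <-trans p (<-trans (n<1+n j) sj<N)) below-j)
        (cong suc (interval-length l k))
        (s≤s z≤n) (≤-<-trans (s≤s (subst (k ≤_) l+k≡j (m≤n+m k l))) sj<N)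
        (S l) (sym (trans (cong (_% N) (sym W≡)) eq))
      where
      below-j : All (_< j) (interval l k)
      below-j = subst (λ n → All (_< n) (interval l k)) l+k≡j (interval-< l k)
      W≡ : W ≡ S l + (f (suc j) + sum (map f (interval l k)))
      W≡ = begin
        S j + f (suc j)                                  ≡⟨ cong (λ n → S n + f (suc j)) (sym l+k≡j) ⟩
        S (l + k) + f (suc j)                            ≡⟨ cong (_+ f (suc j)) (prefixSum-+ f l k) ⟩
        S l + sum (map f (interval l k)) + f (suc j)     ≡⟨ shuffle (S l) _ (f (suc j)) ⟩
        S l + (f (suc j) + sum (map f (interval l k)))   ∎
        where
        open ≡-Reasoning
        shuffle : ∀ a b c → a + b + c ≡ a + (c + b)
        shuffle = solve-∀

    skip-above-zeroSum : ∀ k → suc j + suc k < N → W ≡ S (suc j + suc k) mod N → ShortZeroSum N f (_< N)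
    skip-above-zeroSum k l<N eq =
      collision-zeroSum (j ∷ interval (suc (suc j)) k)
        (All.map (λ p e → <⇒≢ (≤-trans (n≤1+n (suc j)) p) e) (interval-≥ (suc (suc j)) k) ∷ interval-unique (suc (suc j)) k)
        (<-trans (n<1+n j) sj<N ∷ All.map (λ p → <-≤-trans p (≤-trans (s≤s (≤-reflexive (sym (+-suc j k)))) (<⇒≤ l<N)))
          (interval-< (suc (suc j)) k))
        (cong suc (interval-length (suc (suc j)) k))
        (s≤s z≤n) (<-≤-trans (s≤s (m≤n+m (suc k) j)) (<⇒≤ l<N))
        W (trans eq (cong (_% N) S≡))
      where
      S≡ : S (suc j + suc k) ≡ W + (f j + sum (map f (interval (suc (suc j)) k)))
      S≡ = trans (prefixSum-+ f (suc j) (suc k)) (shuffle (S j) (f j) (f (suc j)) _)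
        where
        shuffle : ∀ a b c d → a + b + (c + d) ≡ a + c + (b + d)
        shuffle = solve-∀

    skip-zeroSum : ∀ l → l < N → W ≡ S l mod N → ShortZeroSum N f (_< N)
    skip-zeroSum l l<N eq with <-cmp l j
    ... | tri< l<j _ _ = let k , l+k≡j = m≤n⇒∃[o]m+o≡n (<⇒≤ l<j) in skip-below-zeroSum l k l+k≡j eq
    ... | tri≈ _ refl _ = ⊥-elim (f≢0 (+-cancelˡ-mod (S l) (trans eq (cong (_% N) (sym (+-identityʳ (S l)))))))
    ... | tri> _ _ j<l with m≤n⇒∃[o]m+o≡n j<l
    ...   | zero  , refl = ⊥-elim (f≢ (sym (+-cancelˡ-mod (S j) (trans eq (cong (λ n → S n % N) (+-identityʳ (suc j)))))))
    ...   | suc k , refl = skip-above-zeroSum k l<N eq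

  window-zeroSum : ∀ j → suc j < N → ¬ f j ≡ f (suc j) mod N → ¬ f (suc j) ≡ 0 mod N → ShortZeroSum N f (_< N)
  window-zeroSum j sj<N f≢ f≢0 = collide (Finₚ.pigeonhole (n<1+n N) residues)
    where
    residues : Fin (suc N) → Fin N
    residues zero    = residue (S j + f (suc j))
    residues (suc t) = residue (S (toℕ t))
    collide : ∃₂ (λ s t → s Fin.< t × residues s ≡ residues t) → ShortZeroSum N f (_< N)
    collide (zero  , suc t , _   , e) = skip-zeroSum j sj<N f≢ f≢0 (toℕ t) (Finₚ.toℕ<n t) (residue≡⇒≡mod e)
    collide (suc s , suc t , s<t , e) = block-zeroSum (s<s⁻¹ s<t) (Finₚ.toℕ<n t) (residue≡⇒≡mod e)

zeroSum : ∀ {N} .{{_ : NonZero N}} (f : ℕ → ℕ) → (∀ {k} → k ≤ N → ¬ f k ≡ 0 mod N) →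
  ∀ {j} → j < N → ¬ f j ≡ f (suc j) mod N → ShortZeroSum N f (_< suc N)
zeroSum f f≢0 {j} j<N f≢ with m≤n⇒m<n∨m≡n j<N
... | inj₁ sj<N =
  ShortZeroSum-map id (λ _ _ e → e) m<n⇒m<1+n (window-zeroSum f j sj<N f≢ (f≢0 (<⇒≤ sj<N)))
zeroSum f f≢0 {zero}  j<N f≢ | inj₂ 1≡N = ⊥-elim (f≢ (N≡1⇒≡-mod (sym 1≡N)))
zeroSum f f≢0 {suc i} j<N f≢ | inj₂ j+1≡N =
  ShortZeroSum-map suc (λ _ _ → suc-injective) s≤s (window-zeroSum (f ∘ suc) i j<N f≢ (f≢0 (≤-reflexive j+1≡N)))

-- Rows of a finite subset of ℤ_N²

module _ {N m : ℕ} .{{_ : NonZero N}} (x : Fin m → ZN² N) (x-inj : Injective _≡_ _≡_ x) (a : Fin N) where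

  OnRow OffRow : Fin m → Set
  OnRow  i = proj₁ (x i) ≡ a
  OffRow i = proj₁ (x i) ≢ a

  private
    onRow? : Decidable OnRow
    onRow? i = proj₁ (x i) Finₚ.≟ a

  offRow : List (Fin m)
  offRow = filter (∁? onRow?) (allFin m)

  m≤N+length-offRow : m ≤ N + length offRow
  m≤N+length-offRow = begin
    m                                        ≡⟨ length-tabulate id ⟨
    length (allFin m)                        ≡⟨ length-filter-∁ onRow? (allFin m) ⟨
    length onRow + length offRow             ≤⟨ +-monoˡ-≤ (length offRow) (Finₚ.injective⇒≤ second-injective) ⟩
    N + length offRow                        ∎
    where
    open ≤-Reasoning
    onRow : List (Fin m)
    onRow = filter onRow? (allFin m)
    onRow-OnRow : ∀ k → OnRow (lookup onRow k)
    onRow-OnRow k = All.lookup (Allₚ.all-filter onRow? (allFin m)) (∈-lookup k)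
    second-injective : Injective _≡_ _≡_ (λ k → proj₂ (x (lookup onRow k)))
    second-injective {k} {k′} e = lookup-injective (Uniqueₚ.filter⁺ onRow? (Uniqueₚ.allFin⁺ m))
      (x-inj (cong₂ _,_ (trans (onRow-OnRow k) (sym (onRow-OnRow k′))) e))

  first second : Fin m → ℕ
  first  i = toℕ (proj₁ (x i))
  second i = toℕ (proj₂ (x i))

  -- The first coordinate minus a, kept in ℕ by adding N.
  offset : Fin m → ℕ
  offset i = first i + (N ∸ toℕ a)

  private
    a+[N∸a]≡N : toℕ a + (N ∸ toℕ a) ≡ N
    a+[N∸a]≡N = m+[n∸m]≡n (<⇒≤ (Finₚ.toℕ<n a))

  onRow⇒offset≡N : ∀ {i} → OnRow i → offset i ≡ N
  onRow⇒offset≡N e = trans (cong (λ b → toℕ b + (N ∸ toℕ a)) e) a+[N∸a]≡N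

  offset≡⇒sameRow : ∀ {i j} → offset i ≡ offset j mod N → proj₁ (x i) ≡ proj₁ (x j)
  offset≡⇒sameRow eq = toℕ-injective-mod (+-cancelʳ-mod (N ∸ toℕ a) eq)

  offset≡0⇒onRow : ∀ {i} → offset i ≡ 0 mod N → OnRow i
  offset≡0⇒onRow eq = toℕ-injective-mod (+-cancelʳ-mod (N ∸ toℕ a) (trans eq (sym N≡0)))
    where
    N≡0 : toℕ a + (N ∸ toℕ a) ≡ 0 mod N
    N≡0 = trans (cong (_% N) a+[N∸a]≡N) (trans (n%n≡0 N) (sym 0%N≡0))

  no-N+1-points-in-a-row : (y : ℕ → Fin m) → (∀ {k k′} → k < suc N → k′ < suc N → y k ≡ y k′ → k ≡ k′) →
    ∀ b → ¬ (∀ {k} → k ≤ N → proj₁ (x (y k)) ≡ b)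
  no-N+1-points-in-a-row y y-injective b in-row
    with i , i′ , i<i′ , e ← Finₚ.pigeonhole (n<1+n N) (λ t → proj₂ (x (y (toℕ t)))) =
    <⇒≢ i<i′ (y-injective (Finₚ.toℕ<n i) (Finₚ.toℕ<n i′) (x-inj (cong₂ _,_ rows e)))
    where
    rows : proj₁ (x (y (toℕ i))) ≡ proj₁ (x (y (toℕ i′)))
    rows = trans (in-row (s≤s⁻¹ (Finₚ.toℕ<n i))) (sym (in-row (s≤s⁻¹ (Finₚ.toℕ<n i′))))

  offRow-zeroSum : N < length offRow → ShortZeroSum N offset OffRow
  offRow-zeroSum N<len = zeroSum-of-y adjacent-differ
    where
    y : ℕ → Fin m
    y = lookupOr (lookup offRow (fromℕ< (≤-<-trans z≤n N<len))) offRow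
    y-OffRow : ∀ {k} → k < suc N → OffRow (y k)
    y-OffRow k<  = lookupOr-All _ (Allₚ.all-filter (∁? onRow?) (allFin m)) (<-≤-trans k< N<len)
    y-injective : ∀ {k k′} → k < suc N → k′ < suc N → y k ≡ y k′ → k ≡ k′
    y-injective k< k′< = lookupOr-injective _ (Uniqueₚ.filter⁺ (∁? onRow?) (Uniqueₚ.allFin⁺ m))
      (<-≤-trans k< N<len) (<-≤-trans k′< N<len)
    offset≢0 : ∀ {k} → k ≤ N → ¬ offset (y k) ≡ 0 mod N
    offset≢0 k≤N = y-OffRow (s≤s k≤N) ∘ offset≡0⇒onRow
    not-all-congruent : ¬ (∀ {j} → j < N → offset (y j) ≡ offset (y (suc j)) mod N)
    not-all-congruent adjacent = no-N+1-points-in-a-row y y-injective _ (offset≡⇒sameRow ∘ congruent)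
      where
      congruent : ∀ {k} → k ≤ N → offset (y k) ≡ offset (y 0) mod N
      congruent {zero}  _   = refl
      congruent {suc k} k<N = trans (sym (adjacent k<N)) (congruent (<⇒≤ k<N))
    adjacent-differ : ∃[ j ] (j < N × ¬ offset (y j) ≡ offset (y (suc j)) mod N)
    adjacent-differ with anyUpTo? (λ j → ¬? (offset (y j) % N ≟ offset (y (suc j)) % N)) N
    ... | yes found = found
    ... | no  none  = ⊥-elim (not-all-congruent (λ j<N → decidable-stable (_ ≟ _) (λ ≢ → none (_ , j<N , ≢))))
    zeroSum-of-y : ∃[ j ] (j < N × ¬ offset (y j) ≡ offset (y (suc j)) mod N) → ShortZeroSum N offset OffRow
    zeroSum-of-y (_ , j<N , offsets≢) =
      ShortZeroSum-map y y-injective y-OffRow (zeroSum (offset ∘ y) offset≢0 j<N offsets≢)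

  first-sum≡0 : ∀ P W → length (P ++ W) ≡ N → sum (map offset P) ≡ 0 mod N → All OnRow W →
    sum (map first (P ++ W)) ≡ 0 mod N
  first-sum≡0 P W length≡N offsets≡0 W-OnRow = begin
    sum (map first L) % N                              ≡⟨ [m+kn]%n≡m%n _ c N ⟨
    (sum (map first L) + c * N) % N                    ≡⟨ cong (λ n → (sum (map first L) + n) % N) length-L*c ⟨
    (sum (map first L) + length L * c) % N             ≡⟨ cong (_% N) (sum-map-+ first c L) ⟨
    sum (map offset L) % N                             ≡⟨ cong (_% N) (sum-map-++ offset P W) ⟩
    (sum (map offset P) + sum (map offset W)) % N      ≡⟨ cong (λ n → (sum (map offset P) + n) % N)
                                                           (sum-map-const offset N (All.map onRow⇒offset≡N W-OnRow)) ⟩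
    (sum (map offset P) + length W * N) % N            ≡⟨ [m+kn]%n≡m%n _ (length W) N ⟩
    sum (map offset P) % N                             ≡⟨ offsets≡0 ⟩
    0 % N                                              ∎
    where
    open ≡-Reasoning
    L : List (Fin m)
    L = P ++ W
    c : ℕ
    c = N ∸ toℕ a
    length-L*c : length L * c ≡ c * N
    length-L*c = trans (cong (_* c) length≡N) (*-comm N c)

  module _ (row : (v : Fin N) → ∃[ i ] (x i ≡ (a , v))) where

    private
      rowAt : ℕ → Fin m
      rowAt v = proj₁ (row (residue v))
      x-rowAt : ∀ v → x (rowAt v) ≡ (a , residue v)
      x-rowAt v = proj₂ (row (residue v))

    row-subset-with-sum : ∀ r → 1 ≤ r → r < N → ∀ t →
      ∃[ W ] (length W ≡ r × Unique W × All OnRow W × (sum (map second W) ≡ t mod N))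
    row-subset-with-sum r 1≤r r<N t =
      let vs , len , u , vs<N , sum≡ = distinct-residues-with-sum r (N ∸ r) (m+[n∸m]≡n (<⇒≤ r<N)) 1≤r (m<n⇒0<n∸m r<N) t
      in  map rowAt vs ,
          trans (length-map rowAt vs) len ,
          unique-map-injectiveOn rowAt-injective vs<N u ,
          Allₚ.map⁺ (All.universal (λ v → cong proj₁ (x-rowAt v)) vs) ,
          trans (cong (λ ws → sum ws % N) (trans (sym (map-∘ vs)) (map-cong second-rowAt vs)))
                (trans (sum-map-% vs) sum≡)
      where
      rowAt-injective : ∀ {v w} → v < N → w < N → rowAt v ≡ rowAt w → v ≡ w
      rowAt-injective {v} {w} v<N w<N e = begin
        v     ≡⟨ m<n⇒m%n≡m v<N ⟨
        v % N ≡⟨ residue≡⇒≡mod (cong proj₂ (trans (sym (x-rowAt v)) (trans (cong x e) (x-rowAt w)))) ⟩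
        w % N ≡⟨ m<n⇒m%n≡m w<N ⟩
        w     ∎
        where open ≡-Reasoning
      second-rowAt : ∀ v → second (rowAt v) ≡ v % N
      second-rowAt v = trans (cong (toℕ ∘ proj₂) (x-rowAt v)) (toℕ-residue v)

    complete : ShortZeroSum N offset OffRow → ∃[ g ] (Injective _≡_ _≡_ g × SumsToZero N {N} (λ j → x (g j)))
    complete Z = assemble
      (row-subset-with-sum (N ∸ length P) (m<n⇒0<n∸m short) (∸-monoʳ-< nonempty (<⇒≤ short)) (pred N * Q))
      where
      open ShortZeroSum Z renaming (elements to P)
      Q : ℕ
      Q = sum (map second P)
      assemble : ∃[ W ] (length W ≡ N ∸ length P × Unique W × All OnRow W × (sum (map second W) ≡ pred N * Q mod N)) →
        ∃[ g ] (Injective _≡_ _≡_ g × SumsToZero N {N} (λ j → x (g j)))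
      assemble (W , length-W , unique-W , W-OnRow , seconds≡) =
        let g , g-inj , Σ-g = enumeration (P ++ W) unique-P++W length-P++W
        in  g , g-inj ,
            trans (cong (_% N) (Σ-g first)) (trans (first-sum≡0 P W length-P++W sum≡0 W-OnRow) 0%N≡0) ,
            trans (cong (_% N) (Σ-g second)) (trans seconds-sum≡0 0%N≡0)
        where
        unique-P++W : Unique (P ++ W)
        unique-P++W = Uniqueₚ.++⁺ unique unique-W λ (i∈P , i∈W) → All.lookup all i∈P (All.lookup W-OnRow i∈W)
        length-P++W : length (P ++ W) ≡ N
        length-P++W = trans (length-++ P) (trans (cong (length P +_) length-W) (m+[n∸m]≡n (<⇒≤ short)))
        seconds-sum≡0 : sum (map second (P ++ W)) ≡ 0 mod N
        seconds-sum≡0 = trans (cong (_% N) (sum-map-++ second P W)) (trans (+-congˡ-mod Q seconds≡) (n+pred[N]*n≡0-mod Q))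

theorem3p2 : (N : ℕ) .{{_ : NonZero N}} (x : Fin (2 * N + 1) → ZN² N) →
    Injective _≡_ _≡_ x → ContainsRow x →
    ∃[ g ] (Injective _≡_ _≡_ g × SumsToZero N {N} (λ (j : Fin N) → x (g j)))
theorem3p2 N x x-inj (a , row) = complete x x-inj a row (offRow-zeroSum x x-inj a N<length-offRow)
  where
  2n+1≡n+[1+n] : ∀ n → 2 * n + 1 ≡ n + suc n
  2n+1≡n+[1+n] = solve-∀
  N<length-offRow : N < length (offRow x x-inj a)
  N<length-offRow = +-cancelˡ-≤ N _ _ (≤-trans (≤-reflexive (sym (2n+1≡n+[1+n] N))) (m≤N+length-offRow x x-inj a))
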